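{- Let $n$ be a positive integer and $y$ any complex number. Then, as an identity of rational functions in $x$, \begin{equation*} \sum_{j=0}^{n}(-1)^{j}{n \brack j }q^{\binom{j+1}{2}-jn}\frac{(y;q)_{n+j}}{(y;q)_{j}(1-xq^{j})}=\frac{(q;q)_{n}(y/x;q)_{n}\,x^{n}}{(x;q)_{n+1}}. \end{equation*}
   Context: $q$ is an indeterminate (or a nonzero complex number, not a root of unity). $(x;q)_{0}=1$, $(x;q)_{n}=\prod_{t=0}^{n-1}(1-q^{t}x)$; ${n \brack j}=\frac{(q;q)_{n}}{(q;q)_{j}(q;q)_{n-j}}$. Here $\frac{(y;q)_{n+j}}{(y;q)_{j}}$ means $(yq^{j};q)_{n}$. -}

module Defs where

open import Level using (Level; _⊔_) renaming (suc to lsuc)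
open import Algebra.Bundles using (CommutativeRing)
open import Data.Nat using (ℕ; zero; suc; _∸_) renaming (_*_ to _*ℕ_; _+_ to _+ℕ_)
open import Data.Nat.Combinatorics using (_C_)
open import Data.Integer using (ℤ; +_; -[1+_]) renaming (_-_ to _-ℤ_)
open import Relation.Nullary using (¬_)

-- A field: a commutative ring with 0 ≠ 1 and a (total) inverse map that is a
-- genuine inverse on nonzero elements (value at 0 is junk and never used).
record Field (c ℓ : Level) : Set (lsuc (c ⊔ ℓ)) where
  field
    commutativeRing : CommutativeRing c ℓ
  open CommutativeRing commutativeRing public
  field
    _⁻¹     : Carrier → Carrier
    ⁻¹-cong : ∀ {a b} → a ≈ b → a ⁻¹ ≈ b ⁻¹
    inverse : ∀ a → ¬ (a ≈ 0#) → a * (a ⁻¹) ≈ 1#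
    0≉1     : ¬ (0# ≈ 1#)

module FieldOps {c ℓ : Level} (F : Field c ℓ) where
  open Field F hiding (zero)

  pow : Carrier → ℕ → Carrier
  pow a zero    = 1#
  pow a (suc m) = a * pow a m

  zpow : Carrier → ℤ → Carrier
  zpow a (+ m)     = pow a m
  zpow a -[1+ m ]  = (pow a (suc m)) ⁻¹

  _/_ : Carrier → Carrier → Carrier
  a / b = a * (b ⁻¹)

  poch : Carrier → Carrier → ℕ → Carrier
  poch a q zero    = 1#
  poch a q (suc m) = poch a q m * (1# - pow q m * a)

  qbinom : Carrier → ℕ → ℕ → Carrier
  qbinom q m j = poch q q m / (poch q q j * poch q q (m ∸ j))

  sumTo : ℕ → (ℕ → Carrier) → Carrier
  sumTo zero    f = f zero
  sumTo (suc m) f = sumTo m f + f (suc m)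

  NotRootOfUnity : Carrier → Set ℓ
  NotRootOfUnity q = ¬ (q ≈ 0#) × (∀ k → ¬ (pow q (suc k) ≈ 1#))
    where open import Data.Product using (_×_)

  -- left-hand side: Σ_j (-1)^j [n j] q^{C(j+1,2) - j n} (y;q)_{n+j}/((y;q)_j (1 - x q^j)),
  -- where (y;q)_{n+j}/(y;q)_j means (y q^j; q)_n
  lhs : Carrier → Carrier → Carrier → ℕ → Carrier
  lhs q y x n = sumTo n (λ j →
      pow (- 1#) j * qbinom q n j
        * zpow q ((+ (suc j C 2)) -ℤ (+ (j *ℕ n)))
        * (poch (y * pow q j) q n / (1# - x * pow q j)))

  rhs : Carrier → Carrier → Carrier → ℕ → Carrier
  rhs q y x n = (poch q q n * poch (y / x) q n * pow x n) / poch x q (suc n)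

{-# OPTIONS --safe #-}
-- Both sides F_n(y, x) of the identity satisfy the recurrence
--   F_{n+1}(y, x) = (1 - q^n y) F_n(y, x) - q^{-n} (1 - q^{2n+1} y) F_n(yq, xq)
-- with F_0(y, x) = 1/(1 - x), so they agree by induction on n. For the sum the
-- recurrence holds term by term, because the two q-Pascal rules combine into
--   [n+1, j+1] (1 - q^{n+j+1} y) = (1 - q^n y) q^{j+1} [n, j+1] + (1 - q^{2n+1} y) [n, j].
-- For the product it is a polynomial identity once (x;q)_{n+2} is written both as
-- (x;q)_{n+1} (1 - q^{n+1} x) and as (1 - x) (xq;q)_{n+1}.
module Submission where

open import Level using (Level)
open import Defs
open import Algebra.Bundles using (CommutativeRing)
import Algebra.Solver.Ring.AlmostCommutativeRing as ACR
open import Data.Integer.Base as ℤ using (ℤ; +_; -[1+_]; +0; +[1+_]; _⊖_; _◃_)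
import Data.Integer.Properties as ℤP
import Data.Sign.Base as Sign
open import Data.Nat as ℕ using (ℕ; zero; suc; _≤_)
import Data.Nat.Properties as ℕP
open import Data.Nat.Combinatorics using (_C_; nCk+nC[k+1]≡[n+1]C[k+1]; nC1≡n)
open import Data.Nat.Tactic.RingSolver using (solve-∀)
open import Data.Maybe using (Maybe; just; nothing)
open import Data.Product using (_,_)
open import Relation.Nullary using (yes; no; ¬_)
open import Relation.Binary.PropositionalEquality as ≡ using (_≡_)

module IntegerCoefficientSolver {c ℓ : Level} (R : CommutativeRing c ℓ) where
  open CommutativeRing R
  open import Algebra.Properties.Ring ring
  open import Algebra.Properties.Semiring.Mult.TCOptimised semiring
  open import Relation.Binary.Reasoning.Setoid setoid

  fromℕ : ℕ → Carrier
  fromℕ n = n × 1#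

  fromℤ : ℤ → Carrier
  fromℤ (+ n)      = fromℕ n
  fromℤ -[1+ n ]   = - fromℕ (suc n)

  fromℤ-⊖ : ∀ m n → fromℤ (m ⊖ n) ≈ fromℕ m - fromℕ n
  fromℤ-⊖ m       zero    = sym (trans (+-congˡ -0#≈0#) (+-identityʳ _))
  fromℤ-⊖ zero    (suc n) = sym (+-identityˡ _)
  fromℤ-⊖ (suc m) (suc n) rewrite ℤP.[1+m]⊖[1+n]≡m⊖n m n = begin
    fromℤ (m ⊖ n)                       ≈⟨ fromℤ-⊖ m n ⟩
    fromℕ m - fromℕ n                   ≈⟨ +-congʳ (xyx⁻¹≈y 1# (fromℕ m)) ⟨
    1# + fromℕ m - 1# - fromℕ n         ≈⟨ +-assoc _ _ _ ⟩
    1# + fromℕ m + (- 1# - fromℕ n)     ≈⟨ +-cong (1+× m 1#) (trans (-‿cong (1+× n 1#)) (sym (-‿+-comm 1# _))) ⟨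
    fromℕ (suc m) - fromℕ (suc n)       ∎

  fromℤ-homo-+ : ∀ i j → fromℤ (i ℤ.+ j) ≈ fromℤ i + fromℤ j
  fromℤ-homo-+ -[1+ m ] -[1+ n ] = begin
    - fromℕ (suc (suc (m ℕ.+ n)))       ≈⟨ -‿cong (reflexive (≡.cong (λ k → fromℕ (suc k)) (ℕP.+-suc m n))) ⟨
    - fromℕ (suc m ℕ.+ suc n)           ≈⟨ -‿cong (×-homo-+ 1# (suc m) (suc n)) ⟩
    - (fromℕ (suc m) + fromℕ (suc n))   ≈⟨ -‿+-comm _ _ ⟨
    - fromℕ (suc m) - fromℕ (suc n)     ∎
  fromℤ-homo-+ -[1+ m ] (+ n)    = trans (fromℤ-⊖ n (suc m)) (+-comm _ _)
  fromℤ-homo-+ (+ m)    -[1+ n ] = fromℤ-⊖ m (suc n)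
  fromℤ-homo-+ (+ m)    (+ n)    = ×-homo-+ 1# m n

  fromℤ-+◃ : ∀ k → fromℤ (Sign.+ ◃ k) ≈ fromℕ k
  fromℤ-+◃ zero    = refl
  fromℤ-+◃ (suc k) = refl

  fromℤ--◃ : ∀ k → fromℤ (Sign.- ◃ k) ≈ - fromℕ k
  fromℤ--◃ zero    = sym -0#≈0#
  fromℤ--◃ (suc k) = refl

  fromℤ-homo-* : ∀ i j → fromℤ (i ℤ.* j) ≈ fromℤ i * fromℤ j
  fromℤ-homo-* (+ m) (+ n) = trans (fromℤ-+◃ (m ℕ.* n)) (×1-homo-* m n)
  fromℤ-homo-* (+ m) -[1+ n ] =
    trans (fromℤ--◃ (m ℕ.* suc n)) (trans (-‿cong (×1-homo-* m (suc n))) (-‿distribʳ-* _ _))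
  fromℤ-homo-* -[1+ m ] (+ n) =
    trans (fromℤ--◃ (suc m ℕ.* n)) (trans (-‿cong (×1-homo-* (suc m) n)) (-‿distribˡ-* _ _))
  fromℤ-homo-* -[1+ m ] -[1+ n ] = begin
    fromℤ (Sign.+ ◃ (suc m ℕ.* suc n))    ≈⟨ fromℤ-+◃ (suc m ℕ.* suc n) ⟩
    fromℕ (suc m ℕ.* suc n)               ≈⟨ ×1-homo-* (suc m) (suc n) ⟩
    fromℕ (suc m) * fromℕ (suc n)         ≈⟨ -‿involutive _ ⟨
    - - (fromℕ (suc m) * fromℕ (suc n))   ≈⟨ -‿cong (-‿distribˡ-* _ _) ⟩
    - (- fromℕ (suc m) * fromℕ (suc n))   ≈⟨ -‿distribʳ-* _ _ ⟩
    - fromℕ (suc m) * - fromℕ (suc n)     ∎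

  fromℤ-homo-‿ : ∀ i → fromℤ (ℤ.- i) ≈ - fromℤ i
  fromℤ-homo-‿ +0       = sym -0#≈0#
  fromℤ-homo-‿ +[1+ n ] = refl
  fromℤ-homo-‿ -[1+ n ] = sym (-‿involutive _)

  fromℤ-morphism : ℤ.+-*-rawRing ACR.-Raw-AlmostCommutative⟶ ACR.fromCommutativeRing R
  fromℤ-morphism = record
    { ⟦_⟧ = fromℤ ; +-homo = fromℤ-homo-+ ; *-homo = fromℤ-homo-* ; -‿homo = fromℤ-homo-‿
    ; 0-homo = refl ; 1-homo = refl }

  fromℤ-≟ : ∀ i j → Maybe (fromℤ i ≈ fromℤ j)
  fromℤ-≟ i j with i ℤP.≟ j
  ... | yes ≡.refl = just refl
  ... | no _       = nothing

  open import Algebra.Solver.Ring ℤ.+-*-rawRing (ACR.fromCommutativeRing R) fromℤ-morphism fromℤ-≟ public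

[1+m]C2≡m+mC2 : ∀ m → suc m C 2 ≡ m ℕ.+ m C 2
[1+m]C2≡m+mC2 m = ≡.trans (≡.sym (nCk+nC[k+1]≡[n+1]C[k+1] m 1)) (≡.cong (ℕ._+ m C 2) (nC1≡n m))

module _ {c ℓ : Level} (F : Field c ℓ) where
  open Field F hiding (zero)
  open FieldOps F
  open IntegerCoefficientSolver commutativeRing
  open import Algebra.Properties.Ring ring using (x∙y⁻¹≈ε⇒x≈y)
  open import Relation.Binary.Reasoning.Setoid setoid

  private
    :1 : ∀ {k} → Polynomial k
    :1 = con (+ 1)

  *-≉0 : ∀ {a b} → ¬ a ≈ 0# → ¬ b ≈ 0# → ¬ a * b ≈ 0#
  *-≉0 {a} {b} a≉0 b≉0 ab≈0 = b≉0 (begin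
    b                ≈⟨ *-identityˡ b ⟨
    1# * b           ≈⟨ *-congʳ (inverse a a≉0) ⟨
    (a * a ⁻¹) * b   ≈⟨ solve 3 (λ a b a⁻¹ → (a :* a⁻¹) :* b := a⁻¹ :* (a :* b)) refl a b (a ⁻¹) ⟩
    a ⁻¹ * (a * b)   ≈⟨ *-congˡ ab≈0 ⟩
    a ⁻¹ * 0#        ≈⟨ zeroʳ _ ⟩
    0#               ∎)

  /-*-cancelʳ : ∀ {a} b → ¬ a ≈ 0# → (b / a) * a ≈ b
  /-*-cancelʳ {a} b a≉0 = begin
    (b * a ⁻¹) * a   ≈⟨ solve 3 (λ a b a⁻¹ → (b :* a⁻¹) :* a := b :* (a :* a⁻¹)) refl a b (a ⁻¹) ⟩
    b * (a * a ⁻¹)   ≈⟨ *-congˡ (inverse a a≉0) ⟩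
    b * 1#           ≈⟨ *-identityʳ b ⟩
    b                ∎

  *-cancelʳ-≉0 : ∀ {a x y} → ¬ a ≈ 0# → x * a ≈ y * a → x ≈ y
  *-cancelʳ-≉0 {a} {x} {y} a≉0 xa≈ya = begin
    x                ≈⟨ /-*-cancelʳ x a≉0 ⟨
    (x * a ⁻¹) * a   ≈⟨ solve 3 (λ a x a⁻¹ → (x :* a⁻¹) :* a := (x :* a) :* a⁻¹) refl a x (a ⁻¹) ⟩
    (x * a) * a ⁻¹   ≈⟨ *-congʳ xa≈ya ⟩
    (y * a) * a ⁻¹   ≈⟨ solve 3 (λ a y a⁻¹ → (y :* a) :* a⁻¹ := (y :* a⁻¹) :* a) refl a y (a ⁻¹) ⟩
    (y * a ⁻¹) * a   ≈⟨ /-*-cancelʳ y a≉0 ⟩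
    y                ∎

  /-cancel-*ʳ : ∀ {x c} y → ¬ x ≈ 0# → ¬ c ≈ 0# → (y * c) / (x * c) ≈ y / x
  /-cancel-*ʳ {x} {c} y x≉0 c≉0 = *-cancelʳ-≉0 (*-≉0 x≉0 c≉0) (begin
    ((y * c) / (x * c)) * (x * c)  ≈⟨ /-*-cancelʳ (y * c) (*-≉0 x≉0 c≉0) ⟩
    y * c                          ≈⟨ *-congʳ (/-*-cancelʳ y x≉0) ⟨
    ((y / x) * x) * c              ≈⟨ *-assoc _ _ _ ⟩
    (y / x) * (x * c)              ∎)

  pow-+ : ∀ a m n → pow a (m ℕ.+ n) ≈ pow a m * pow a n
  pow-+ a zero    n = sym (*-identityˡ _)
  pow-+ a (suc m) n = trans (*-congˡ (pow-+ a m n)) (sym (*-assoc _ _ _))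

  pow-distrib-* : ∀ a b n → pow (a * b) n ≈ pow a n * pow b n
  pow-distrib-* a b zero    = sym (*-identityˡ 1#)
  pow-distrib-* a b (suc n) = trans (*-congˡ (pow-distrib-* a b n))
    (solve 4 (λ a b u v → (a :* b) :* (u :* v) := (a :* u) :* (b :* v)) refl a b (pow a n) (pow b n))

  pow-≉0 : ∀ {a} n → ¬ a ≈ 0# → ¬ pow a n ≈ 0#
  pow-≉0 zero    a≉0 1≈0 = 0≉1 (sym 1≈0)
  pow-≉0 (suc n) a≉0     = *-≉0 a≉0 (pow-≉0 n a≉0)

  zpow-⊖ : ∀ {a} → ¬ a ≈ 0# → ∀ m n → zpow a (m ⊖ n) * pow a n ≈ pow a m
  zpow-⊖ a≉0 m       zero    = *-identityʳ _
  zpow-⊖ a≉0 zero    (suc n) = trans (*-comm _ _) (inverse _ (pow-≉0 (suc n) a≉0))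
  zpow-⊖ {a} a≉0 (suc m) (suc n) rewrite ℤP.[1+m]⊖[1+n]≡m⊖n m n = begin
    zpow a (m ⊖ n) * (a * pow a n)   ≈⟨ solve 3 (λ z a p → z :* (a :* p) := a :* (z :* p)) refl (zpow a (m ⊖ n)) a (pow a n) ⟩
    a * (zpow a (m ⊖ n) * pow a n)   ≈⟨ *-congˡ (zpow-⊖ a≉0 m n) ⟩
    a * pow a m                      ∎

  zpow-[+m]-[+n] : ∀ {a} → ¬ a ≈ 0# → ∀ m n → zpow a (+ m ℤ.- + n) * pow a n ≈ pow a m
  zpow-[+m]-[+n] a≉0 m n rewrite ℤP.[+m]-[+n]≡m⊖n m n = zpow-⊖ a≉0 m n

  zpow-shift : ∀ {a} → ¬ a ≈ 0# → ∀ m n m′ n′ k → m ℕ.+ n′ ≡ m′ ℕ.+ (k ℕ.+ n) →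
    zpow a (+ m ℤ.- + n) ≈ zpow a (+ m′ ℤ.- + n′) * pow a k
  zpow-shift {a} a≉0 m n m′ n′ k eq = *-cancelʳ-≉0 (*-≉0 (pow-≉0 n a≉0) (pow-≉0 n′ a≉0)) (begin
    z * (pow a n * pow a n′)               ≈⟨ *-assoc _ _ _ ⟨
    (z * pow a n) * pow a n′               ≈⟨ *-congʳ (zpow-[+m]-[+n] a≉0 m n) ⟩
    pow a m * pow a n′                     ≈⟨ pow-+ a m n′ ⟨
    pow a (m ℕ.+ n′)                       ≈⟨ reflexive (≡.cong (pow a) eq) ⟩
    pow a (m′ ℕ.+ (k ℕ.+ n))               ≈⟨ trans (pow-+ a m′ _) (*-congˡ (pow-+ a k n)) ⟩
    pow a m′ * (pow a k * pow a n)         ≈⟨ *-congʳ (zpow-[+m]-[+n] a≉0 m′ n′) ⟨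
    (z′ * pow a n′) * (pow a k * pow a n)
      ≈⟨ solve 4 (λ z′ v u w → (z′ :* v) :* (u :* w) := (z′ :* u) :* (w :* v)) refl z′ (pow a n′) (pow a k) (pow a n) ⟩
    (z′ * pow a k) * (pow a n * pow a n′)  ∎)
    where
    z  = zpow a (+ m ℤ.- + n)
    z′ = zpow a (+ m′ ℤ.- + n′)

  poch-cong : ∀ {a b} q m → a ≈ b → poch a q m ≈ poch b q m
  poch-cong q zero    a≈b = refl
  poch-cong q (suc m) a≈b = *-cong (poch-cong q m a≈b) (+-congˡ (-‿cong (*-congˡ a≈b)))

  poch-suc : ∀ a q m → poch a q (suc m) ≈ (1# - a) * poch (a * q) q m
  poch-suc a q zero    = solve 1 (λ a → :1 :* (:1 :- :1 :* a) := (:1 :- a) :* :1) refl a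
  poch-suc a q (suc m) = begin
    poch a q (suc m) * (1# - pow q (suc m) * a)               ≈⟨ *-congʳ (poch-suc a q m) ⟩
    ((1# - a) * poch (a * q) q m) * (1# - pow q (suc m) * a)
      ≈⟨ solve 4 (λ a P u q → ((:1 :- a) :* P) :* (:1 :- (q :* u) :* a) := (:1 :- a) :* (P :* (:1 :- u :* (a :* q))))
           refl a (poch (a * q) q m) (pow q m) q ⟩
    (1# - a) * (poch (a * q) q m * (1# - pow q m * (a * q)))   ∎

  poch-≉0-init : ∀ a q m → ¬ poch a q (suc m) ≈ 0# → ¬ poch a q m ≈ 0#
  poch-≉0-init a q m ≉0 ≈0 = ≉0 (trans (*-congʳ ≈0) (zeroˡ _))

  poch-≉0-shift : ∀ a q m → ¬ poch a q (suc m) ≈ 0# → ¬ poch (a * q) q m ≈ 0#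
  poch-≉0-shift a q m ≉0 ≈0 = ≉0 (trans (poch-suc a q m) (trans (*-congˡ ≈0) (zeroʳ _)))

  sumTo-recurrence : ∀ n (f g h : ℕ → Carrier) A B → f 0 ≈ A * g 0 →
    (∀ j → j ℕ.< n → f (suc j) ≈ A * g (suc j) + B * h j) → f (suc n) ≈ B * h n →
    sumTo (suc n) f ≈ A * sumTo n g + B * sumTo n h
  sumTo-recurrence n f g h A B f₀ fₛ fₙ = trans (+-congˡ fₙ) (shifted n fₛ)
    where
    shifted : ∀ m → (∀ j → j ℕ.< m → f (suc j) ≈ A * g (suc j) + B * h j) →
      sumTo m f + B * h m ≈ A * sumTo m g + B * sumTo m h
    shifted zero    _  = +-congʳ f₀
    shifted (suc m) fₛ′ = begin
      (sumTo m f + f (suc m)) + B * h (suc m)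
        ≈⟨ +-congʳ (+-congˡ (fₛ′ m (ℕP.n<1+n m))) ⟩
      (sumTo m f + (A * g (suc m) + B * h m)) + B * h (suc m)
        ≈⟨ solve 6 (λ S A B h g′ h′ → (S :+ (A :* g′ :+ B :* h)) :+ B :* h′ := (S :+ B :* h) :+ (A :* g′ :+ B :* h′))
             refl (sumTo m f) A B (h m) (g (suc m)) (h (suc m)) ⟩
      (sumTo m f + B * h m) + (A * g (suc m) + B * h (suc m))
        ≈⟨ +-congʳ (shifted m (λ j j<m → fₛ′ j (ℕP.m<n⇒m<1+n j<m))) ⟩
      (A * sumTo m g + B * sumTo m h) + (A * g (suc m) + B * h (suc m))
        ≈⟨ solve 6 (λ A B G H g h → (A :* G :+ B :* H) :+ (A :* g :+ B :* h) := A :* (G :+ g) :+ B :* (H :+ h))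
             refl A B (sumTo m g) (sumTo m h) (g (suc m)) (h (suc m)) ⟩
      A * sumTo (suc m) g + B * sumTo (suc m) h   ∎

  module _ (q : Carrier) (q≉0 : ¬ q ≈ 0#) (q-not-root : ∀ k → ¬ pow q (suc k) ≈ 1#) where

    poch-q≉0 : ∀ k → ¬ poch q q k ≈ 0#
    poch-q≉0 zero    1≈0 = 0≉1 (sym 1≈0)
    poch-q≉0 (suc k)     = *-≉0 (poch-q≉0 k)
      (λ 1-qᵏq≈0 → q-not-root k (trans (*-comm q _) (sym (x∙y⁻¹≈ε⇒x≈y 1# _ 1-qᵏq≈0))))

    qbinom-spec : ∀ a b {m} → a ℕ.+ b ≡ m → qbinom q m a * (poch q q a * poch q q b) ≈ poch q q m
    qbinom-spec a b ≡.refl =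
      trans (*-congˡ (*-congˡ (reflexive (≡.cong (poch q q) (≡.sym (ℕP.m+n∸m≡n a b))))))
            (/-*-cancelʳ _ (*-≉0 (poch-q≉0 a) (poch-q≉0 (a ℕ.+ b ℕ.∸ a))))

    qbinom-unique : ∀ a b {m X} → a ℕ.+ b ≡ m → X * (poch q q a * poch q q b) ≈ poch q q m → qbinom q m a ≈ X
    qbinom-unique a b eq XD≈poch =
      *-cancelʳ-≉0 (*-≉0 (poch-q≉0 a) (poch-q≉0 b)) (trans (qbinom-spec a b eq) (sym XD≈poch))

    qbinom-zero : ∀ k → qbinom q k 0 ≈ 1#
    qbinom-zero k = qbinom-unique 0 k ≡.refl (trans (*-identityˡ _) (*-identityˡ _))

    qbinom-diag : ∀ k → qbinom q k k ≈ 1#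
    qbinom-diag k = qbinom-unique k 0 (ℕP.+-identityʳ k) (trans (*-identityˡ _) (*-identityʳ _))

    poch-q-suc-+ : ∀ j o → poch q q (suc j ℕ.+ o) * (1# - ((q * pow q j) * pow q o) * q) ≈ poch q q (suc (suc j ℕ.+ o))
    poch-q-suc-+ j o = *-congˡ (+-congˡ (-‿cong (*-congʳ (sym (pow-+ q (suc j) o)))))

    qbinom-pascalˡ : ∀ {n j} → j ℕ.< n →
      qbinom q (suc n) (suc j) ≈ pow q (suc j) * qbinom q n (suc j) + qbinom q n j
    qbinom-pascalˡ {n} {j} j<n with ℕP.m≤n⇒∃[o]m+o≡n j<n
    ... | o , ≡.refl = qbinom-unique (suc j) (suc o) (ℕP.+-suc (suc j) o) (begin
      (Q₁ * M + N) * ((Pⱼ * (1# - t * q)) * (Pₒ * (1# - u * q)))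
        ≈⟨ solve 8 (λ q t u M N Pⱼ Pₒ Q₁ → (Q₁ :* M :+ N) :* ((Pⱼ :* (:1 :- t :* q)) :* (Pₒ :* (:1 :- u :* q)))
             := (Q₁ :* (:1 :- u :* q)) :* (M :* ((Pⱼ :* (:1 :- t :* q)) :* Pₒ)) :+ (:1 :- t :* q) :* (N :* (Pⱼ :* (Pₒ :* (:1 :- u :* q)))))
             refl q t u M N Pⱼ Pₒ Q₁ ⟩
      (Q₁ * (1# - u * q)) * (M * ((Pⱼ * (1# - t * q)) * Pₒ)) + (1# - t * q) * (N * (Pⱼ * (Pₒ * (1# - u * q))))
        ≈⟨ +-cong (*-congˡ (qbinom-spec (suc j) o ≡.refl)) (*-congˡ (qbinom-spec j (suc o) (ℕP.+-suc j o))) ⟩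
      (Q₁ * (1# - u * q)) * Pₙ + (1# - t * q) * Pₙ
        ≈⟨ solve 4 (λ q t u Pₙ → ((q :* t) :* (:1 :- u :* q)) :* Pₙ :+ (:1 :- t :* q) :* Pₙ := Pₙ :* (:1 :- ((q :* t) :* u) :* q))
             refl q t u Pₙ ⟩
      Pₙ * (1# - ((q * t) * u) * q)
        ≈⟨ poch-q-suc-+ j o ⟩
      poch q q (suc (suc j ℕ.+ o))   ∎)
      where
      t = pow q j
      u = pow q o
      Q₁ = pow q (suc j)
      M = qbinom q (suc j ℕ.+ o) (suc j)
      N = qbinom q (suc j ℕ.+ o) j
      Pⱼ = poch q q j
      Pₒ = poch q q o
      Pₙ = poch q q (suc j ℕ.+ o)

    qbinom-pascalʳ : ∀ {n j} → j ℕ.< n →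
      qbinom q (suc n) (suc j) ≈ qbinom q n (suc j) + pow q (n ℕ.∸ j) * qbinom q n j
    qbinom-pascalʳ {n} {j} j<n with ℕP.m≤n⇒∃[o]m+o≡n j<n
    ... | o , ≡.refl = qbinom-unique (suc j) (suc o) (ℕP.+-suc (suc j) o) (begin
      (M + pow q (suc j ℕ.+ o ℕ.∸ j) * N) * ((Pⱼ * (1# - t * q)) * (Pₒ * (1# - u * q)))
        ≈⟨ *-congʳ (+-congˡ (*-congʳ (reflexive (≡.cong (pow q) n∸j≡1+o)))) ⟩
      (M + (q * u) * N) * ((Pⱼ * (1# - t * q)) * (Pₒ * (1# - u * q)))
        ≈⟨ solve 7 (λ q t u M N Pⱼ Pₒ → (M :+ (q :* u) :* N) :* ((Pⱼ :* (:1 :- t :* q)) :* (Pₒ :* (:1 :- u :* q)))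
             := (:1 :- u :* q) :* (M :* ((Pⱼ :* (:1 :- t :* q)) :* Pₒ)) :+ ((q :* u) :* (:1 :- t :* q)) :* (N :* (Pⱼ :* (Pₒ :* (:1 :- u :* q)))))
             refl q t u M N Pⱼ Pₒ ⟩
      (1# - u * q) * (M * ((Pⱼ * (1# - t * q)) * Pₒ)) + ((q * u) * (1# - t * q)) * (N * (Pⱼ * (Pₒ * (1# - u * q))))
        ≈⟨ +-cong (*-congˡ (qbinom-spec (suc j) o ≡.refl)) (*-congˡ (qbinom-spec j (suc o) (ℕP.+-suc j o))) ⟩
      (1# - u * q) * Pₙ + ((q * u) * (1# - t * q)) * Pₙ
        ≈⟨ solve 4 (λ q t u Pₙ → (:1 :- u :* q) :* Pₙ :+ ((q :* u) :* (:1 :- t :* q)) :* Pₙ := Pₙ :* (:1 :- ((q :* t) :* u) :* q))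
             refl q t u Pₙ ⟩
      Pₙ * (1# - ((q * t) * u) * q)
        ≈⟨ poch-q-suc-+ j o ⟩
      poch q q (suc (suc j ℕ.+ o))   ∎)
      where
      t = pow q j
      u = pow q o
      M = qbinom q (suc j ℕ.+ o) (suc j)
      N = qbinom q (suc j ℕ.+ o) j
      Pⱼ = poch q q j
      Pₒ = poch q q o
      Pₙ = poch q q (suc j ℕ.+ o)
      n∸j≡1+o : suc j ℕ.+ o ℕ.∸ j ≡ suc o
      n∸j≡1+o = ≡.trans (≡.cong (ℕ._∸ j) (≡.sym (ℕP.+-suc j o))) (ℕP.m+n∸m≡n j (suc o))

    qbinom-recurrence : ∀ {n j} y → j ℕ.< n →
      qbinom q (suc n) (suc j) * (1# - pow q n * (y * pow q (suc j)))
        ≈ (1# - pow q n * y) * qbinom q n (suc j) * pow q (suc j) + (1# - pow q n * (y * pow q (suc n))) * qbinom q n j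
    qbinom-recurrence {n} {j} y j<n = begin
      K * (1# - Q * (y * Q₁))
        ≈⟨ solve 4 (λ K Q y Q₁ → K :* (:1 :- Q :* (y :* Q₁)) := K :- Q :* y :* (Q₁ :* K)) refl K Q y Q₁ ⟩
      K - Q * y * (Q₁ * K)
        ≈⟨ +-cong (qbinom-pascalˡ j<n) (-‿cong (*-congˡ Q₁K≈Q₁M+Qₙ₊₁N)) ⟩
      (Q₁ * M + N) - Q * y * (Q₁ * M + Qₙ₊₁ * N)
        ≈⟨ solve 6 (λ M N Q₁ Q Qₙ₊₁ y → (Q₁ :* M :+ N) :- Q :* y :* (Q₁ :* M :+ Qₙ₊₁ :* N)
             := (:1 :- Q :* y) :* M :* Q₁ :+ (:1 :- Q :* (y :* Qₙ₊₁)) :* N) refl M N Q₁ Q Qₙ₊₁ y ⟩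
      (1# - Q * y) * M * Q₁ + (1# - Q * (y * Qₙ₊₁)) * N   ∎
      where
      K = qbinom q (suc n) (suc j)
      M = qbinom q n (suc j)
      N = qbinom q n j
      Q = pow q n
      Q₁ = pow q (suc j)
      Qₙ₊₁ = pow q (suc n)
      Q₁K≈Q₁M+Qₙ₊₁N : Q₁ * K ≈ Q₁ * M + Qₙ₊₁ * N
      Q₁K≈Q₁M+Qₙ₊₁N = begin
        Q₁ * K                                ≈⟨ *-congˡ (qbinom-pascalʳ j<n) ⟩
        Q₁ * (M + pow q (n ℕ.∸ j) * N)        ≈⟨ trans (distribˡ _ _ _) (+-congˡ (sym (*-assoc _ _ _))) ⟩
        Q₁ * M + (Q₁ * pow q (n ℕ.∸ j)) * N   ≈⟨ +-congˡ (*-congʳ (sym (pow-+ q (suc j) (n ℕ.∸ j)))) ⟩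
        Q₁ * M + pow q (suc j ℕ.+ (n ℕ.∸ j)) * N
          ≈⟨ +-congˡ (*-congʳ (reflexive (≡.cong (λ k → pow q (suc k)) (ℕP.m+[n∸m]≡n (ℕP.<⇒≤ j<n))))) ⟩
        Q₁ * M + Qₙ₊₁ * N                     ∎

    exponent : ℕ → ℕ → ℤ
    exponent n j = + (suc j C 2) ℤ.- + (j ℕ.* n)

    zpow-exponent-suc : ∀ n j → zpow q (exponent n (suc j)) ≈ zpow q (exponent (suc n) (suc j)) * pow q (suc j)
    zpow-exponent-suc n j = zpow-shift q≉0 (suc (suc j) C 2) (suc j ℕ.* n) (suc (suc j) C 2) (suc j ℕ.* suc n) (suc j)
       (≡.cong (suc (suc j) C 2 ℕ.+_) (ℕP.*-suc (suc j) n))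

    zpow-exponent-pred : ∀ n j → zpow q (exponent n j) ≈ zpow q (exponent (suc n) (suc j)) * pow q n
    zpow-exponent-pred n j = zpow-shift q≉0 (suc j C 2) (j ℕ.* n) (suc (suc j) C 2) (suc j ℕ.* suc n) n
      (≡.trans (arithmetic (suc j C 2) j n) (≡.cong (ℕ._+ (n ℕ.+ j ℕ.* n)) (≡.sym ([1+m]C2≡m+mC2 (suc j)))))
      where
      arithmetic : ∀ c j n → c ℕ.+ suc j ℕ.* suc n ≡ (suc j ℕ.+ c) ℕ.+ (n ℕ.+ j ℕ.* n)
      arithmetic = solve-∀

    term : ℕ → Carrier → Carrier → ℕ → Carrier
    term n y x j = pow (- 1#) j * qbinom q n j * zpow q (exponent n j) * (poch (y * pow q j) q n / (1# - x * pow q j))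

    shiftCoeff : ℕ → Carrier → Carrier
    shiftCoeff n y = - (1# - pow q n * (y * pow q (suc n))) * pow q n ⁻¹

    term-shift : ∀ n y x j → term n (y * q) (x * q) j
      ≈ pow (- 1#) j * qbinom q n j * (zpow q (exponent (suc n) (suc j)) * pow q n)
          * (poch (y * pow q (suc j)) q n / (1# - x * pow q (suc j)))
    term-shift n y x j = *-cong (*-congˡ (zpow-exponent-pred n j))
      (*-cong (poch-cong q n (*-assoc y q (pow q j))) (⁻¹-cong (+-congˡ (-‿cong (*-assoc x q (pow q j))))))

    term-zero-step : ∀ n y x → term (suc n) y x 0 ≈ (1# - pow q n * y) * term n y x 0
    term-zero-step n y x = begin
      1# * K * E * ((P * (1# - Q * (y * 1#))) * d)
        ≈⟨ *-congʳ (*-congʳ (*-congˡ (trans (qbinom-zero (suc n)) (sym (qbinom-zero n))))) ⟩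
      1# * M * E * ((P * (1# - Q * (y * 1#))) * d)
        ≈⟨ solve 6 (λ M E P Q y d → :1 :* M :* E :* ((P :* (:1 :- Q :* (y :* :1))) :* d) := (:1 :- Q :* y) :* (:1 :* M :* E :* (P :* d)))
             refl M E P Q y d ⟩
      (1# - Q * y) * (1# * M * E * (P * d))   ∎
      where
      K = qbinom q (suc n) 0
      M = qbinom q n 0
      E = zpow q (exponent n 0)
      P = poch (y * 1#) q n
      Q = pow q n
      d = (1# - x * 1#) ⁻¹

    term-suc-step : ∀ n y x j → j ℕ.< n →
      term (suc n) y x (suc j) ≈ (1# - pow q n * y) * term n y x (suc j) + shiftCoeff n y * term n (y * q) (x * q) j
    term-suc-step n y x j j<n = sym (begin
      A * ((- 1# * s) * M * E₁ * (P * d)) + (- b₀ * Q ⁻¹) * term n (y * q) (x * q) j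
        ≈⟨ +-cong (*-congˡ (*-congʳ (*-congˡ (zpow-exponent-suc n j)))) (*-congˡ (term-shift n y x j)) ⟩
      A * ((- 1# * s) * M * (E * Q₁) * (P * d)) + (- b₀ * Q ⁻¹) * (s * N * (E * Q) * (P * d))
        ≈⟨ solve 11 (λ A M N E Q Q⁻¹ Q₁ s b₀ P d →
             A :* ((:- :1 :* s) :* M :* (E :* Q₁) :* (P :* d)) :+ (:- b₀ :* Q⁻¹) :* (s :* N :* (E :* Q) :* (P :* d))
             := ((:- :1 :* s) :* E :* (P :* d)) :* (A :* M :* Q₁ :+ b₀ :* N :* (Q :* Q⁻¹)))
             refl A M N E Q (Q ⁻¹) Q₁ s b₀ P d ⟩
      ((- 1# * s) * E * (P * d)) * (A * M * Q₁ + b₀ * N * (Q * Q ⁻¹))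
        ≈⟨ *-congˡ (+-congˡ (trans (*-congˡ (inverse Q (pow-≉0 n q≉0))) (*-identityʳ _))) ⟩
      ((- 1# * s) * E * (P * d)) * (A * M * Q₁ + b₀ * N)
        ≈⟨ *-congˡ (qbinom-recurrence y j<n) ⟨
      ((- 1# * s) * E * (P * d)) * (K * w)
        ≈⟨ solve 6 (λ s E P d K w → ((:- :1 :* s) :* E :* (P :* d)) :* (K :* w) := (:- :1 :* s) :* K :* E :* ((P :* w) :* d))
             refl s E P d K w ⟩
      (- 1# * s) * K * E * ((P * w) * d)   ∎)
      where
      s = pow (- 1#) j
      K = qbinom q (suc n) (suc j)
      M = qbinom q n (suc j)
      N = qbinom q n j
      E = zpow q (exponent (suc n) (suc j))
      E₁ = zpow q (exponent n (suc j))
      Q = pow q n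
      Q₁ = pow q (suc j)
      A = 1# - Q * y
      b₀ = 1# - Q * (y * pow q (suc n))
      w = 1# - Q * (y * Q₁)
      P = poch (y * Q₁) q n
      d = (1# - x * Q₁) ⁻¹

    term-top-step : ∀ n y x → term (suc n) y x (suc n) ≈ shiftCoeff n y * term n (y * q) (x * q) n
    term-top-step n y x = sym (begin
      (- b₀ * Q ⁻¹) * term n (y * q) (x * q) n
        ≈⟨ *-congˡ (term-shift n y x n) ⟩
      (- b₀ * Q ⁻¹) * (s * N * (E * Q) * (P * d))
        ≈⟨ *-congˡ (*-congʳ (*-congʳ (*-congˡ (trans (qbinom-diag n) (sym (qbinom-diag (suc n))))))) ⟩
      (- b₀ * Q ⁻¹) * (s * K * (E * Q) * (P * d))
        ≈⟨ solve 8 (λ s K E Q Q⁻¹ P b₀ d → (:- b₀ :* Q⁻¹) :* (s :* K :* (E :* Q) :* (P :* d))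
             := ((:- :1 :* s) :* K :* E :* ((P :* b₀) :* d)) :* (Q :* Q⁻¹))
             refl s K E Q (Q ⁻¹) P b₀ d ⟩
      ((- 1# * s) * K * E * ((P * b₀) * d)) * (Q * Q ⁻¹)
        ≈⟨ trans (*-congˡ (inverse Q (pow-≉0 n q≉0))) (*-identityʳ _) ⟩
      (- 1# * s) * K * E * ((P * b₀) * d)   ∎)
      where
      s = pow (- 1#) n
      K = qbinom q (suc n) (suc n)
      N = qbinom q n n
      E = zpow q (exponent (suc n) (suc n))
      Q = pow q n
      b₀ = 1# - Q * (y * pow q (suc n))
      P = poch (y * pow q (suc n)) q n
      d = (1# - x * pow q (suc n)) ⁻¹

    lhs-recurrence : ∀ n y x →
      lhs q y x (suc n) ≈ (1# - pow q n * y) * lhs q y x n + shiftCoeff n y * lhs q (y * q) (x * q) n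
    lhs-recurrence n y x = sumTo-recurrence n (term (suc n) y x) (term n y x) (term n (y * q) (x * q)) _ _
      (term-zero-step n y x) (term-suc-step n y x) (term-top-step n y x)

    rhs-recurrence : ∀ n y x → ¬ x ≈ 0# → ¬ poch x q (suc (suc n)) ≈ 0# →
      (1# - pow q n * y) * rhs q y x n + shiftCoeff n y * rhs q (y * q) (x * q) n ≈ rhs q y x (suc n)
    rhs-recurrence n y x x≉0 D₃≉0 = *-cancelʳ-≉0 D₃≉0 (begin
      (A * (N / D₁) + B * rhs q (y * q) (x * q) n) * D₃
        ≈⟨ trans (distribʳ D₃ _ _) (+-congˡ (*-cong (*-congˡ shifted-rhs) (poch-suc x q (suc n)))) ⟩
      (A * (N / D₁)) * (D₁ * f₁) + (B * (N′ / D₂)) * ((1# - x) * D₂)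
        ≈⟨ solve 8 (λ A B f₁ x r₁ r₂ D₁ D₂ → (A :* r₁) :* (D₁ :* f₁) :+ (B :* r₂) :* ((:1 :- x) :* D₂)
             := (A :* f₁) :* (r₁ :* D₁) :+ (B :* (:1 :- x)) :* (r₂ :* D₂)) refl A B f₁ x (N / D₁) (N′ / D₂) D₁ D₂ ⟩
      (A * f₁) * ((N / D₁) * D₁) + (B * (1# - x)) * ((N′ / D₂) * D₂)
        ≈⟨ +-cong (*-congˡ (/-*-cancelʳ N (poch-≉0-init x q (suc n) D₃≉0))) (*-congˡ (/-*-cancelʳ N′ (poch-≉0-shift x q (suc n) D₃≉0))) ⟩
      (A * f₁) * N + (B * (1# - x)) * N′
        ≈⟨ solve 8 (λ Cₙ P X Q Q⁻¹ q x y →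
             ((:1 :- Q :* y) :* (:1 :- (q :* Q) :* x)) :* (Cₙ :* P :* X) :+ ((:- (:1 :- Q :* (y :* (q :* Q)))) :* Q⁻¹ :* (:1 :- x)) :* (Cₙ :* P :* (X :* Q))
             := (Cₙ :* P :* X) :* ((:1 :- Q :* y) :* (:1 :- (q :* Q) :* x) :- (:1 :- Q :* (y :* (q :* Q)))  :* (:1 :- x) :* (Q :* Q⁻¹)))
             refl Cₙ Pyx xⁿ Q (Q ⁻¹) q x y ⟩
      N * (A * f₁ - b₀ * (1# - x) * (Q * Q ⁻¹))
        ≈⟨ *-congˡ (+-congˡ (-‿cong (*-congˡ (inverse Q (pow-≉0 n q≉0))))) ⟩
      N * (A * f₁ - b₀ * (1# - x) * 1#)
        ≈⟨ solve 7 (λ Cₙ P X Q q y x → (Cₙ :* P :* X) :* ((:1 :- Q :* y) :* (:1 :- (q :* Q) :* x) :- (:1 :- Q :* (y :* (q :* Q))) :* (:1 :- x) :* :1)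
             := Cₙ :* (:1 :- Q :* q) :* P :* X :* (x :- Q :* y :* :1)) refl Cₙ Pyx xⁿ Q q y x ⟩
      Cₙ * (1# - Q * q) * Pyx * xⁿ * (x - Q * y * 1#)
        ≈⟨ *-congˡ (+-congˡ (-‿cong (*-congˡ (inverse x x≉0)))) ⟨
      Cₙ * (1# - Q * q) * Pyx * xⁿ * (x - Q * y * (x * x ⁻¹))
        ≈⟨ solve 8 (λ Cₙ P X Q q y x x⁻¹ → Cₙ :* (:1 :- Q :* q) :* P :* X :* (x :- Q :* y :* (x :* x⁻¹))
             := Cₙ :* (:1 :- Q :* q) :* (P :* (:1 :- Q :* (y :* x⁻¹))) :* (x :* X)) refl Cₙ Pyx xⁿ Q q y x (x ⁻¹) ⟩
      N₃
        ≈⟨ /-*-cancelʳ N₃ D₃≉0 ⟨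
      (N₃ / D₃) * D₃  ∎)
      where
      Cₙ = poch q q n
      Q = pow q n
      xⁿ = pow x n
      Pyx = poch (y / x) q n
      A = 1# - Q * y
      b₀ = 1# - Q * (y * pow q (suc n))
      B = shiftCoeff n y
      f₁ = 1# - pow q (suc n) * x
      N = Cₙ * Pyx * xⁿ
      N′ = Cₙ * Pyx * (xⁿ * Q)
      N₃ = Cₙ * (1# - Q * q) * (Pyx * (1# - Q * (y / x))) * (x * xⁿ)
      D₁ = poch x q (suc n)
      D₂ = poch (x * q) q (suc n)
      D₃ = poch x q (suc (suc n))
      shifted-rhs : rhs q (y * q) (x * q) n ≈ N′ / D₂
      shifted-rhs = *-congʳ (*-cong (*-congˡ (poch-cong q n (/-cancel-*ʳ y x≉0 q≉0))) (pow-distrib-* x q n))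

    lhs≈rhs : ∀ n y x → ¬ x ≈ 0# → ¬ poch x q (suc n) ≈ 0# → lhs q y x n ≈ rhs q y x n
    lhs≈rhs zero y x _ _ = begin
      1# * qbinom q 0 0 * 1# * (1# * (1# - x * 1#) ⁻¹)
        ≈⟨ *-cong (*-congʳ (*-congˡ (qbinom-zero 0)))
                  (*-congˡ (⁻¹-cong (solve 1 (λ x → :1 :- x :* :1 := :1 :* (:1 :- :1 :* x)) refl x))) ⟩
      1# * 1# * 1# * (1# * (1# * (1# - 1# * x)) ⁻¹)
        ≈⟨ solve 1 (λ d → :1 :* :1 :* :1 :* (:1 :* d) := (:1 :* :1 :* :1) :* d) refl _ ⟩
      (1# * 1# * 1#) * (1# * (1# - 1# * x)) ⁻¹   ∎
    lhs≈rhs (suc n) y x x≉0 D≉0 = begin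
      lhs q y x (suc n)
        ≈⟨ lhs-recurrence n y x ⟩
      (1# - pow q n * y) * lhs q y x n + shiftCoeff n y * lhs q (y * q) (x * q) n
        ≈⟨ +-cong (*-congˡ (lhs≈rhs n y x x≉0 (poch-≉0-init x q (suc n) D≉0))) (*-congˡ 
                  (lhs≈rhs n (y * q) (x * q) (*-≉0 x≉0 q≉0) (poch-≉0-shift x q (suc n) D≉0))) ⟩
      (1# - pow q n * y) * rhs q y x n + shiftCoeff n y * rhs q (y * q) (x * q) n
        ≈⟨ rhs-recurrence n y x x≉0 D≉0 ⟩
      rhs q y x (suc n)   ∎

mainTheorem15 : ∀ {c ℓ} (F : Field c ℓ) →
    (n : ℕ) → 1 ≤ n → (q y x : Field.Carrier F) → FieldOps.NotRootOfUnity F q →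
    ¬ (Field._≈_ F x (Field.0# F)) →
    ¬ (Field._≈_ F (FieldOps.poch F x q (suc n)) (Field.0# F)) →
    Field._≈_ F (FieldOps.lhs F q y x n) (FieldOps.rhs F q y x n)
-- The identity holds for n = 0 as well.
mainTheorem15 F n _ q y x (q≉0 , q-not-root) x≉0 D≉0 = lhs≈rhs F q q≉0 q-not-root n y x x≉0 D≉0
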